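{- Let $n\ge 1$ and let $w_0\in S_n$ be the longest permutation, $w_0(k)=n+1-k$. On the poset of circular permutations of $S_n$, the maps $\sigma\mapsto\sigma^{ -1}$ and $\sigma\mapsto w_0\circ\sigma\circ w_0$ are anti-automorphisms of the poset (order-reversing bijections).
   Context: Permutations of $\{1,\dots,n\}$ are viewed as words; a circular factor of a word $w$ is a contiguous factor of some cyclic rotation $yx$ of $w=xy$. A circular permutation is an $n$-cycle in $S_n$; $(w)$ denotes the $n$-cycle $w_1\mapsto w_2\mapsto\cdots\mapsto w_n\mapsto w_1$. The poset of circular permutations is ordered by the reflexive transitive closure of the relation $(w)\to(w')$, which holds when $w$ has a circular factor $sr$ with $s>r+1$ and $w'$ is obtained from $w$ by replacing this factor by $rs$. -}

module Defs where

open import Data.Nat using (ℕ; suc; _<_)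
open import Data.Nat.DivMod using (_%_; m%n<n)
open import Data.Fin using (Fin; toℕ; fromℕ<)
open import Data.Fin.Permutation using (Permutation′; _⟨$⟩ʳ_; _≈_; transpose; _∘ₚ_)
open import Data.Product using (Σ; ∃; _×_)
open import Function.Bundles using (_⇔_)
open import Relation.Binary.PropositionalEquality using (_≡_)

next : ∀ {n} → Fin n → Fin n
next {suc m} i = fromℕ< (m%n<n (suc (toℕ i)) (suc m))

-- A permutation w of {1..n} viewed as a word: its i-th letter is w ⟨$⟩ʳ i
-- (positions and letters are 0-indexed via Fin n).
-- σ is the n-cycle (w) : w₁ ↦ w₂ ↦ ⋯ ↦ wₙ ↦ w₁.
IsCycleOf : ∀ {n} → Permutation′ n → Permutation′ n → Set
IsCycleOf w σ = ∀ i → σ ⟨$⟩ʳ (w ⟨$⟩ʳ i) ≡ w ⟨$⟩ʳ next i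

IsCircular : ∀ {n} → Permutation′ n → Set
IsCircular {n} σ = Σ (Permutation′ n) λ w → IsCycleOf w σ

-- (w) → (w'): w has a circular factor s r (positions i, i+1 mod n of w)
-- with s > r + 1, and w' is w with this factor replaced by r s.
Step : ∀ {n} → Permutation′ n → Permutation′ n → Set
Step {n} σ τ =
  Σ (Permutation′ n) λ w → IsCycleOf w σ ×
  Σ (Fin n) λ i →
    (suc (toℕ (w ⟨$⟩ʳ next i)) < toℕ (w ⟨$⟩ʳ i)) ×
    IsCycleOf (transpose i (next i) ∘ₚ w) τ

data _≤c_ {n} : Permutation′ n → Permutation′ n → Set where
  done : ∀ {σ τ} → σ ≈ τ → σ ≤c τ
  step : ∀ {σ ρ τ} → Step σ ρ → ρ ≤c τ → σ ≤c τ

IsAntiAutomorphism : ∀ n → (Permutation′ n → Permutation′ n) → Set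
IsAntiAutomorphism n f =
  (∀ σ → IsCircular σ → IsCircular (f σ)) ×
  (∀ σ τ → IsCircular σ → IsCircular τ → f σ ≈ f τ → σ ≈ τ) ×
  (∀ τ → IsCircular τ → ∃ λ σ → IsCircular σ × f σ ≈ τ) ×
  (∀ σ τ → IsCircular σ → IsCircular τ → (σ ≤c τ ⇔ f τ ≤c f σ))

-- The inverse of (w) is (w read backwards), and conjugating by w₀ replaces
-- every letter k of w by n + 1 − k.  If w′ arises from w by turning a circular
-- factor s r with s > r + 1 into r s, then the image of w′ again has such a
-- factor — s r in w′ read backwards, (n+1−r) (n+1−s) in the complement of
-- w′ — and swapping it gives back the image of w.  So each map reverses the
-- covering steps, and an involution that does so is an anti-automorphism.
module Submission where

open import Defs
open import Data.Nat using (ℕ; _≤_)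
open import Data.Product using (_×_)
open import Data.Fin.Permutation using (flip; reverse; _∘ₚ_)

open import Data.Nat using (suc; _<_; _∸_; _%_; z<s; s<s)
open import Data.Nat.Properties
  using (m≤n⇒m<n∨m≡n; +-∸-assoc; n∸n≡0; ∸-monoʳ-<; n<1+n; ≤-<-trans; <-≤-trans; <⇒≤)
open import Data.Nat.DivMod using (m<n⇒m%n≡m; n%n≡0)
open import Data.Fin using (Fin; toℕ; opposite; _≟_)
open import Data.Fin.Properties
  using (toℕ-injective; toℕ-fromℕ<; opposite-prop; opposite-involutive; toℕ≤pred[n])
open import Data.Fin.Permutation
  using (Permutation′; _⟨$⟩ʳ_; _⟨$⟩ˡ_; _≈_; transpose; inverseˡ; inverseʳ)
import Data.Fin.Permutation.Components as PC
open import Data.Product using (_,_)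
open import Data.Sum using (inj₁; inj₂)
open import Relation.Nullary using (Dec; yes; no; contradiction)
open import Function.Base using (_∘_)
open import Function.Bundles using (mk⇔)
open import Relation.Binary.PropositionalEquality
open ≡-Reasoning

module _ {n : ℕ} where

  transpose-matchˡ : (i j : Fin n) → PC.transpose i j i ≡ j
  transpose-matchˡ i j with i ≟ i
  ... | yes _   = refl
  ... | no i≢i = contradiction refl i≢i

  transpose-matchʳ : (i j : Fin n) → PC.transpose i j j ≡ i
  transpose-matchʳ i j with j ≟ i
  ... | yes j≡i = j≡i
  ... | no _ with j ≟ j
  ...   | yes _   = refl
  ...   | no j≢j = contradiction refl j≢j

  transpose-other : (i j k : Fin n) → k ≢ i → k ≢ j → PC.transpose i j k ≡ k
  transpose-other i j k k≢i k≢j with k ≟ i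
  ... | yes k≡i = contradiction k≡i k≢i
  ... | no _ with k ≟ j
  ...   | yes k≡j = contradiction k≡j k≢j
  ...   | no _    = refl

  transpose-comm : (i j k : Fin n) → PC.transpose i j k ≡ PC.transpose j i k
  transpose-comm i j k = by-cases (k ≟ i) (k ≟ j)
    where
    by-cases : Dec (k ≡ i) → Dec (k ≡ j) → PC.transpose i j k ≡ PC.transpose j i k
    by-cases (yes refl) _          = trans (transpose-matchˡ k j) (sym (transpose-matchʳ j k))
    by-cases (no _)     (yes refl) = trans (transpose-matchʳ i k) (sym (transpose-matchˡ k i))
    by-cases (no k≢i)   (no k≢j)   =
      trans (transpose-other i j k k≢i k≢j) (sym (transpose-other j i k k≢j k≢i))

  transpose-involutive : (i j k : Fin n) → PC.transpose i j (PC.transpose i j k) ≡ k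
  transpose-involutive i j k =
    trans (cong (PC.transpose i j) (transpose-comm i j k)) (PC.transpose-inverse i j)

  transpose-conjugate : (g : Fin n → Fin n) → (∀ x → g (g x) ≡ x) →
                        (a b k : Fin n) →
                        g (PC.transpose (g a) (g b) k) ≡ PC.transpose a b (g k)
  transpose-conjugate g g-invol a b k = by-cases (k ≟ g a) (k ≟ g b)
    where
    T = PC.transpose
    g-injective : ∀ {x} → g k ≡ x → k ≡ g x
    g-injective gk≡x = trans (sym (g-invol k)) (cong g gk≡x)
    by-cases : Dec (k ≡ g a) → Dec (k ≡ g b) → g (T (g a) (g b) k) ≡ T a b (g k)
    by-cases (yes refl) _ = begin
      g (T (g a) (g b) (g a)) ≡⟨ cong g (transpose-matchˡ (g a) (g b)) ⟩
      g (g b)                 ≡⟨ g-invol b ⟩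
      b                       ≡⟨ transpose-matchˡ a b ⟨
      T a b a                 ≡⟨ cong (T a b) (g-invol a) ⟨
      T a b (g (g a))         ∎
    by-cases (no _) (yes refl) = begin
      g (T (g a) (g b) (g b)) ≡⟨ cong g (transpose-matchʳ (g a) (g b)) ⟩
      g (g a)                 ≡⟨ g-invol a ⟩
      a                       ≡⟨ transpose-matchʳ a b ⟨
      T a b b                 ≡⟨ cong (T a b) (g-invol b) ⟨
      T a b (g (g b))         ∎
    by-cases (no k≢ga) (no k≢gb) =
      trans (cong g (transpose-other (g a) (g b) k k≢ga k≢gb))
            (sym (transpose-other a b (g k) (k≢ga ∘ g-injective) (k≢gb ∘ g-injective)))

module _ {m : ℕ} where

  toℕ-next-< : (k : Fin (suc m)) → toℕ k < m → toℕ (next k) ≡ suc (toℕ k)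
  toℕ-next-< k k<m = trans (toℕ-fromℕ< _) (m<n⇒m%n≡m (s<s k<m))

  toℕ-next-last : (k : Fin (suc m)) → toℕ k ≡ m → toℕ (next k) ≡ 0
  toℕ-next-last k k≡m =
    trans (toℕ-fromℕ< _) (trans (cong (λ x → suc x % suc m) k≡m) (n%n≡0 (suc m)))

  next-opposite-next : (k : Fin (suc m)) → next (opposite (next k)) ≡ opposite k
  next-opposite-next k with m≤n⇒m<n∨m≡n (toℕ≤pred[n] k)
  ... | inj₁ k<m = toℕ-injective (begin
    toℕ (next (opposite (next k))) ≡⟨ toℕ-next-< _ opposite-next<m ⟩
    suc (toℕ (opposite (next k)))  ≡⟨ cong suc toℕ-opposite-next ⟩
    suc (m ∸ suc (toℕ k))          ≡⟨ +-∸-assoc 1 k<m ⟨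
    m ∸ toℕ k                      ≡⟨ opposite-prop k ⟨
    toℕ (opposite k)               ∎)
    where
    toℕ-opposite-next : toℕ (opposite (next k)) ≡ m ∸ suc (toℕ k)
    toℕ-opposite-next = trans (opposite-prop (next k)) (cong (m ∸_) (toℕ-next-< k k<m))
    opposite-next<m : toℕ (opposite (next k)) < m
    opposite-next<m = subst (_< m) (sym toℕ-opposite-next) (∸-monoʳ-< z<s k<m)
  ... | inj₂ k≡m = toℕ-injective (begin
    toℕ (next (opposite (next k))) ≡⟨ toℕ-next-last _ toℕ-opposite-next ⟩
    0                              ≡⟨ n∸n≡0 m ⟨
    m ∸ m                          ≡⟨ cong (m ∸_) k≡m ⟨
    m ∸ toℕ k                      ≡⟨ opposite-prop k ⟨
    toℕ (opposite k)               ∎)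
    where
    toℕ-opposite-next : toℕ (opposite (next k)) ≡ m
    toℕ-opposite-next = trans (opposite-prop (next k)) (cong (m ∸_) (toℕ-next-last k k≡m))

_≫_ : ∀ {n} → Fin n → Fin n → Set
s ≫ r = suc (toℕ r) < toℕ s

opposite-reverses-≫ : ∀ {m} {r s : Fin (suc m)} → s ≫ r → opposite r ≫ opposite s
opposite-reverses-≫ {m} {r} {s} r+1<s =
  subst₂ (λ a b → suc a < b) (sym (opposite-prop s)) (sym (opposite-prop r))
    (≤-<-trans (∸-monoʳ-< r+1<s s≤m) (∸-monoʳ-< (n<1+n (toℕ r)) r+1≤m))
  where
  s≤m : toℕ s ≤ m
  s≤m = toℕ≤pred[n] s
  r+1≤m : suc (toℕ r) ≤ m
  r+1≤m = <⇒≤ (<-≤-trans r+1<s s≤m)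

module _ {n : ℕ} where

  private
    P = Permutation′ n

  -- π ∘ₚ ρ applies π first: this exchanges the letters at positions i and i + 1.
  swapAt : Fin n → P → P
  swapAt i w = transpose i (next i) ∘ₚ w

  swapAt-at : (i : Fin n) (w : P) → swapAt i w ⟨$⟩ʳ i ≡ w ⟨$⟩ʳ next i
  swapAt-at i w = cong (w ⟨$⟩ʳ_) (transpose-matchˡ i (next i))

  swapAt-at-next : (i : Fin n) (w : P) → swapAt i w ⟨$⟩ʳ next i ≡ w ⟨$⟩ʳ i
  swapAt-at-next i w = cong (w ⟨$⟩ʳ_) (transpose-matchʳ i (next i))

  swapAt-involutive : (i : Fin n) (w : P) → swapAt i (swapAt i w) ≈ w
  swapAt-involutive i w k = cong (w ⟨$⟩ʳ_) (transpose-involutive i (next i) k)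

  IsCycleOf-respˡ-≈ : (w w′ σ : P) → w ≈ w′ → IsCycleOf w σ → IsCycleOf w′ σ
  IsCycleOf-respˡ-≈ w w′ σ w≈w′ cyc i =
    trans (cong (σ ⟨$⟩ʳ_) (sym (w≈w′ i))) (trans (cyc i) (w≈w′ (next i)))

  IsCycleOf-respʳ-≈ : (w σ σ′ : P) → σ ≈ σ′ → IsCycleOf w σ → IsCycleOf w σ′
  IsCycleOf-respʳ-≈ w σ σ′ σ≈σ′ cyc i = trans (sym (σ≈σ′ (w ⟨$⟩ʳ i))) (cyc i)

  Step-respˡ-≈ : {σ σ′ τ : P} → σ ≈ σ′ → Step σ τ → Step σ′ τ
  Step-respˡ-≈ {σ} {σ′} σ≈σ′ (w , cyc , i , gap , cyc′) =
    w , IsCycleOf-respʳ-≈ w σ σ′ σ≈σ′ cyc , i , gap , cyc′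

  ≤c-respˡ-≈ : {σ σ′ τ : P} → σ ≈ σ′ → σ ≤c τ → σ′ ≤c τ
  ≤c-respˡ-≈ σ≈σ′ (done σ≈τ) = done (λ x → trans (sym (σ≈σ′ x)) (σ≈τ x))
  ≤c-respˡ-≈ {σ} {σ′} σ≈σ′ (step {ρ = ρ} s ρ≤τ) =
    step (Step-respˡ-≈ {σ} {σ′} {ρ} σ≈σ′ s) ρ≤τ

  ≤c-respʳ-≈ : {σ τ τ′ : P} → τ ≈ τ′ → σ ≤c τ → σ ≤c τ′
  ≤c-respʳ-≈ τ≈τ′ (done σ≈τ)   = done (λ x → trans (σ≈τ x) (τ≈τ′ x))
  ≤c-respʳ-≈ τ≈τ′ (step s ρ≤τ) = step s (≤c-respʳ-≈ τ≈τ′ ρ≤τ)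

  ≤c-trans : {σ ρ τ : P} → σ ≤c ρ → ρ ≤c τ → σ ≤c τ
  ≤c-trans (done σ≈ρ)    ρ≤τ = ≤c-respˡ-≈ (λ x → sym (σ≈ρ x)) ρ≤τ
  ≤c-trans (step s σ′≤ρ) ρ≤τ = step s (≤c-trans σ′≤ρ ρ≤τ)

  Step⇒≤c : {σ τ : P} → Step σ τ → σ ≤c τ
  Step⇒≤c {τ = τ} s = step {ρ = τ} s (done (λ _ → refl))

  involution-reversing-Step⇒isAntiAutomorphism :
    (f : P → P) →
    (∀ σ τ → σ ≈ τ → f σ ≈ f τ) →
    (∀ σ → f (f σ) ≈ σ) →
    (∀ σ → IsCircular σ → IsCircular (f σ)) →
    (∀ σ τ → Step σ τ → Step (f τ) (f σ)) →
    IsAntiAutomorphism n f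
  involution-reversing-Step⇒isAntiAutomorphism f f-cong f-invol f-circular f-Step =
      f-circular
    , (λ σ τ _ _ fσ≈fτ x →
         trans (sym (f-invol σ x)) (trans (f-cong (f σ) (f τ) fσ≈fτ x) (f-invol τ x)))
    , (λ τ circ → f τ , f-circular τ circ , f-invol τ)
    , (λ σ τ _ _ → mk⇔ reverses
        (λ fτ≤fσ → ≤c-respˡ-≈ (f-invol σ) (≤c-respʳ-≈ (f-invol τ) (reverses fτ≤fσ))))
    where
    reverses : ∀ {σ τ} → σ ≤c τ → f τ ≤c f σ
    reverses {σ} {τ} (done σ≈τ)       = done (f-cong τ σ (λ x → sym (σ≈τ x)))
    reverses {σ} (step {ρ = ρ} s ρ≤τ) = ≤c-trans (reverses ρ≤τ) (Step⇒≤c (f-Step σ ρ s))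

flip-cong : ∀ {n} (σ τ : Permutation′ n) → σ ≈ τ → flip σ ≈ flip τ
flip-cong σ τ σ≈τ x = begin
  σ ⟨$⟩ˡ x                   ≡⟨ cong (σ ⟨$⟩ˡ_) (inverseʳ τ) ⟨
  σ ⟨$⟩ˡ (τ ⟨$⟩ʳ (τ ⟨$⟩ˡ x)) ≡⟨ cong (σ ⟨$⟩ˡ_) (σ≈τ _) ⟨
  σ ⟨$⟩ˡ (σ ⟨$⟩ʳ (τ ⟨$⟩ˡ x)) ≡⟨ inverseˡ σ ⟩
  τ ⟨$⟩ˡ x                   ∎

module _ {m : ℕ} where

  private
    P = Permutation′ (suc m)

  IsCycleOf-flip : (w σ : P) → IsCycleOf w σ → IsCycleOf (reverse ∘ₚ w) (flip σ)
  IsCycleOf-flip w σ cyc k = begin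
    σ ⟨$⟩ˡ (w ⟨$⟩ʳ opposite k)
      ≡⟨ cong (λ x → σ ⟨$⟩ˡ (w ⟨$⟩ʳ x)) (next-opposite-next k) ⟨
    σ ⟨$⟩ˡ (w ⟨$⟩ʳ next (opposite (next k)))
      ≡⟨ cong (σ ⟨$⟩ˡ_) (cyc (opposite (next k))) ⟨
    σ ⟨$⟩ˡ (σ ⟨$⟩ʳ (w ⟨$⟩ʳ opposite (next k)))
      ≡⟨ inverseˡ σ ⟩
    w ⟨$⟩ʳ opposite (next k)
      ∎

  IsCircular-flip : (σ : P) → IsCircular σ → IsCircular (flip σ)
  IsCircular-flip σ (w , cyc) = reverse ∘ₚ w , IsCycleOf-flip w σ cyc

  reverse-swapAt : (i : Fin (suc m)) (w : P) →
                   reverse ∘ₚ swapAt i w ≈ swapAt (opposite (next i)) (reverse ∘ₚ w)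
  reverse-swapAt i w k = cong (w ⟨$⟩ʳ_) (begin
    PC.transpose i (next i) (opposite k)
      ≡⟨ transpose-comm i (next i) (opposite k) ⟩
    PC.transpose (next i) i (opposite k)
      ≡⟨ transpose-conjugate opposite opposite-involutive (next i) i k ⟨
    opposite (PC.transpose (opposite (next i)) (opposite i) k)
      ≡⟨ cong (λ x → opposite (PC.transpose j x k)) (next-opposite-next i) ⟨
    opposite (PC.transpose j (next j) k)
      ∎)
    where
    j = opposite (next i)

  Step-flip : (σ τ : P) → Step σ τ → Step (flip τ) (flip σ)
  Step-flip σ τ (w , cyc , i , gap , cyc′) =
    u , IsCycleOf-flip (swapAt i w) τ cyc′ , j , gap′ ,
    IsCycleOf-respˡ-≈ (reverse ∘ₚ w) (swapAt j u) (flip σ) reverse-w≈swapAt-j-u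
      (IsCycleOf-flip w σ cyc)
    where
    j = opposite (next i)
    u = reverse ∘ₚ swapAt i w
    u-at-j : u ⟨$⟩ʳ j ≡ w ⟨$⟩ʳ i
    u-at-j = trans (cong (swapAt i w ⟨$⟩ʳ_) (opposite-involutive (next i))) (swapAt-at-next i w)
    u-at-next-j : u ⟨$⟩ʳ next j ≡ w ⟨$⟩ʳ next i
    u-at-next-j = trans (cong (λ x → swapAt i w ⟨$⟩ʳ opposite x) (next-opposite-next i))
                 (trans (cong (swapAt i w ⟨$⟩ʳ_) (opposite-involutive i)) (swapAt-at i w))
    gap′ : (u ⟨$⟩ʳ j) ≫ (u ⟨$⟩ʳ next j)
    gap′ = subst₂ _≫_ (sym u-at-j) (sym u-at-next-j) gap
    reverse-w≈swapAt-j-u : reverse ∘ₚ w ≈ swapAt j u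
    reverse-w≈swapAt-j-u k =
      trans (sym (swapAt-involutive i w (opposite k))) (reverse-swapAt i (swapAt i w) k)

conj : ∀ {n} → Permutation′ n → Permutation′ n
conj σ = reverse ∘ₚ σ ∘ₚ reverse

module _ {m : ℕ} where

  private
    P = Permutation′ (suc m)

  conj-cong : (σ τ : P) → σ ≈ τ → conj σ ≈ conj τ
  conj-cong σ τ σ≈τ x = cong opposite (σ≈τ (opposite x))

  conj-involutive : (σ : P) → conj (conj σ) ≈ σ
  conj-involutive σ x = trans (opposite-involutive _) (cong (σ ⟨$⟩ʳ_) (opposite-involutive x))

  IsCycleOf-conj : (w σ : P) → IsCycleOf w σ → IsCycleOf (w ∘ₚ reverse) (conj σ)
  IsCycleOf-conj w σ cyc k =
    cong opposite (trans (cong (σ ⟨$⟩ʳ_) (opposite-involutive _)) (cyc k))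

  IsCircular-conj : (σ : P) → IsCircular σ → IsCircular (conj σ)
  IsCircular-conj σ (w , cyc) = w ∘ₚ reverse , IsCycleOf-conj w σ cyc

  Step-conj : (σ τ : P) → Step σ τ → Step (conj τ) (conj σ)
  Step-conj σ τ (w , cyc , i , gap , cyc′) =
    u , IsCycleOf-conj (swapAt i w) τ cyc′ , i , gap′ ,
    IsCycleOf-respˡ-≈ (w ∘ₚ reverse) (swapAt i u) (conj σ)
      (λ k → cong opposite (sym (swapAt-involutive i w k)))
      (IsCycleOf-conj w σ cyc)
    where
    u = swapAt i w ∘ₚ reverse
    gap′ : (u ⟨$⟩ʳ i) ≫ (u ⟨$⟩ʳ next i)
    gap′ = subst₂ (λ a b → opposite a ≫ opposite b)
             (sym (swapAt-at i w)) (sym (swapAt-at-next i w)) (opposite-reverses-≫ gap)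

corollary2p5 : (n : ℕ) → 1 ≤ n →
    IsAntiAutomorphism n flip × IsAntiAutomorphism n (λ σ → reverse ∘ₚ σ ∘ₚ reverse)
corollary2p5 (suc m) _ =
    involution-reversing-Step⇒isAntiAutomorphism
      flip flip-cong (λ _ _ → refl) IsCircular-flip Step-flip
  , involution-reversing-Step⇒isAntiAutomorphism
      conj conj-cong conj-involutive IsCircular-conj Step-conj
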